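{- Let $G_i$ be a contracted graph obtained from the initial (all-singleton) graph $G_1$ by performing a sequence of $1$-good merges. Then for adjacent vertices $u,v$ of $G_i$, the merge of $u$ and $v$ in $G_i$ is $1$-good if and only if $w(u,v)=\max(w_{\max}(u),w_{\max}(v))$.
   Context: Let $G=(V,E,w)$ be a finite undirected graph with positive edge weights. A cluster is a nonempty subset of $V$. For disjoint clusters $X,Y$ define $w(X,Y)=\frac{1}{|X|\,|Y|}\sum_{xy\in E,\ x\in X,\ y\in Y} w(xy)$. Given a partition of $V$ into clusters, the contracted graph has the clusters as vertices, with an edge between $X,Y$ iff $w(X,Y)>0$, of weight $w(X,Y)$. Initially every vertex is a singleton cluster. Merging two adjacent clusters $u,v$ replaces them by $u\cup v$. $w_{\max}(v)$ is the maximum weight of an edge incident to $v$ in the current graph (0 if none). $M(v)=\infty$ for singletons and $M(u\cup v)=\min(M(u),M(v),w(u,v))$ when $u,v$ are merged. For $\epsilon\ge 0$, a merge of adjacent $u,v$ in the current graph is $(1+\epsilon)$-good if $\frac{\max(w_{\max}(u),w_{\max}(v))}{\min(M(u),M(v),w(u,v))}\le 1+\epsilon$; "$1$-good" is the case $\epsilon=0$.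
   Formalization: The edge weights of G are rational rather than real, so the weights $w(X,Y)$, the values $w_{\max}(v)$ and the finite values of M are rational too. -}

module Defs where

open import Data.Nat as ℕ using (ℕ; suc)
open import Data.Integer using (+_)
open import Data.Rational using (ℚ; 0ℚ; 1ℚ; _+_; _*_; _/_; _⊔_; _⊓_; _≤_; _<_)
open import Data.Fin using (Fin)
open import Data.List as List using (List; []; _∷_; allFin)
open import Data.List.NonEmpty as List⁺ using (List⁺; _⁺++⁺_; [_])
open import Data.Maybe using (Maybe; just; nothing)
open import Data.Product using (Σ; _×_; _,_; proj₁; proj₂; ∃-syntax)
open import Relation.Binary.PropositionalEquality using (_≡_)
open import Relation.Binary.Construct.Closure.ReflexiveTransitive using (Star)
open import Data.List.Relation.Binary.Permutation.Propositional using (_↭_)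

-- A weighted graph on vertex set Fin n: a weight function, symmetric and
-- nonnegative; the edges are exactly the pairs with positive weight.
record WGraph (n : ℕ) : Set where
  field
    w     : Fin n → Fin n → ℚ
    sym   : ∀ x y → w x y ≡ w y x
    nonneg : ∀ x y → 0ℚ ≤ w x y

Cluster : ℕ → Set
Cluster n = List⁺ (Fin n)

-- M-value: nothing = ∞, just q = finite value q.
MVal : Set
MVal = Maybe ℚ

Node : ℕ → Set
Node n = Cluster n × MVal

-- The current (contracted) graph: the list of its clusters (a partition of V).
State : ℕ → Set
State n = List (Node n)

sumℚ : List ℚ → ℚ
sumℚ = List.foldr _+_ 0ℚ

module _ {n : ℕ} (G : WGraph n) where
  open WGraph G

  cut : Cluster n → Cluster n → ℚ
  cut X Y = sumℚ (List.map (λ x → sumℚ (List.map (λ y → w x y) (List⁺.toList Y))) (List⁺.toList X))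

  avg : ℚ → ℕ → ℕ → ℚ
  avg s a b = s * ((+ 1) / (suc a ℕ.* suc b))

  -- w(X,Y) = (1/(|X||Y|)) Σ_{x∈X, y∈Y} w(xy)
  W : Cluster n → Cluster n → ℚ
  W X Y = avg (cut X Y) (List.length (List⁺.tail X)) (List.length (List⁺.tail Y))

  Wn : Node n → Node n → ℚ
  Wn u v = W (proj₁ u) (proj₁ v)

  -- w_max(u) where `others` are all the other vertices of the current graph
  -- (non-neighbours contribute weight 0; empty maximum is 0)
  wmax : Node n → List (Node n) → ℚ
  wmax u others = List.foldr (λ v m → Wn u v ⊔ m) 0ℚ others

  minM : MVal → ℚ → ℚ
  minM nothing  q = q
  minM (just m) q = m ⊓ q

  minMuv : Node n → Node n → ℚ
  minMuv u v = minM (proj₂ u) (minM (proj₂ v) (Wn u v))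

  Adjacent : Node n → Node n → Set
  Adjacent u v = 0ℚ < Wn u v

  -- the merge of u and v in the current graph  u ∷ v ∷ rest  is (1+ε)-good:
  -- max(wmax u, wmax v) / min(M u, M v, w(u,v)) ≤ 1+ε
  -- (the denominator is positive for adjacent u,v, so we clear it)
  Good : ℚ → Node n → Node n → List (Node n) → Set
  Good ε u v rest =
    (wmax u (v ∷ rest) ⊔ wmax v (u ∷ rest)) ≤ (1ℚ + ε) * minMuv u v

  merge : Node n → Node n → Node n
  merge u v = (proj₁ u ⁺++⁺ proj₁ v , just (minMuv u v))

  data GoodStep (ε : ℚ) : State n → State n → Set where
    step : ∀ {P} u v rest → P ↭ (u ∷ v ∷ rest) → Adjacent u v →
           Good ε u v rest → GoodStep ε P (merge u v ∷ rest)

  initial : State n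
  initial = List.map (λ x → ([ x ] , nothing)) (allFin n)

  ReachableBy1Good : State n → Set
  ReachableBy1Good P = Star (GoodStep 0ℚ) initial P

{-# OPTIONS --safe #-}
module Submission where

-- Invariant: in every graph reached by 1-good merges, each weight w(x,y) is at
-- most M(x) and at most M(y).  It holds trivially for singletons (M = ∞).  When
-- u and v are merged, w(u ∪ v, x) is a weighted mean of w(u,x) and w(v,x), hence
-- at most their maximum, which is at most M(x), and also at most
-- max(wmax u, wmax v) ≤ M(u ∪ v) because the merge is 1-good.  Consequently
-- min(M u, M v, w(u,v)) = w(u,v), so 1-goodness of merging u and v says exactly
-- max(wmax u, wmax v) ≤ w(u,v), and the reverse inequality always holds.  The
-- argument applies to every pair of clusters, adjacent or not.

open import Defs
open import Data.Nat using (ℕ)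
open import Data.List using (List; _∷_)
open import Data.Rational using (ℚ; 0ℚ; _⊔_)
open import Data.List.Relation.Binary.Permutation.Propositional using (_↭_)
open import Relation.Binary.PropositionalEquality using (_≡_)
open import Function.Bundles using (_⇔_)

open import Data.Nat as ℕ using (suc; NonZero)
import Data.Integer as ℤ
import Data.Integer.Properties as ℤ
import Data.Nat.Properties as ℕ
open import Data.Rational using (1ℚ; _+_; _*_; _/_; 1/_; _≤_; NonNegative)
open import Data.Rational.Literals using (fromℤ)
open import Data.Rational.Properties
open import Algebra.Bundles using (CommutativeMonoid)
open import Algebra.Properties.CommutativeSemigroup (CommutativeMonoid.commutativeSemigroup +-0-commutativeMonoid)
  using (interchange)
open import Data.Rational.Unnormalised using (*≡*)
import Data.Rational.Unnormalised.Properties as ℚᵘ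
open import Data.Fin using (Fin)
open import Data.List as List using ([]; _++_)
import Data.List.Properties as List
open import Data.List.NonEmpty.Properties using (length-⁺++⁺)
open import Data.List.NonEmpty as List⁺ using (_⁺++⁺_; [_]) renaming (length to ∣_∣)
open import Data.Maybe using (just; nothing)
open import Data.Product using (_×_; _,_; proj₁; proj₂)
open import Data.Unit using (⊤; tt)
open import Data.List.Membership.Propositional using (_∈_)
open import Data.List.Relation.Unary.Any using (here; there)
open import Data.List.Relation.Unary.All as All using (_∷_)
import Data.List.Relation.Unary.All.Properties as All
open import Data.List.Relation.Unary.AllPairs using (AllPairs; []; _∷_)
open import Data.List.Relation.Binary.Permutation.Propositional using (↭⇒↭ₛ)
open import Relation.Binary.Construct.Closure.ReflexiveTransitive using (Star; ε; _◅_)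
open import Relation.Binary.PropositionalEquality
  using (refl; sym; trans; cong; cong₂; subst; resp₂)
import Relation.Binary.PropositionalEquality as ≡
open import Relation.Binary.Definitions using (Symmetric)
open import Function.Bundles using (mk⇔; Equivalence)

fromℕ : ℕ → ℚ
fromℕ k = fromℤ (ℤ.+ k)

fromℕ-+ : ∀ m n → fromℕ (m ℕ.+ n) ≡ fromℕ m + fromℕ n
fromℕ-+ m n = toℚᵘ-injective (ℚᵘ.≃-sym (ℚᵘ.≃-trans (toℚᵘ-homo-+ (fromℕ m) (fromℕ n)) (*≡* cross-products)))
  where
  cross-products : (ℤ.+ m ℤ.* ℤ.1ℤ ℤ.+ ℤ.+ n ℤ.* ℤ.1ℤ) ℤ.* ℤ.1ℤ ≡ ℤ.+ (m ℕ.+ n) ℤ.* ℤ.1ℤ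
  cross-products = cong (ℤ._* ℤ.1ℤ) (trans (cong₂ ℤ._+_ (ℤ.*-identityʳ (ℤ.+ m)) (ℤ.*-identityʳ (ℤ.+ n))) (sym (ℤ.pos-+ m n)))

1/ℕ : (K : ℕ) .{{_ : NonZero K}} → ℚ
1/ℕ K = ℤ.+ 1 / K

1/ℕ-nonNeg : ∀ K .{{_ : NonZero K}} → NonNegative (1/ℕ K)
1/ℕ-nonNeg K = normalize-nonNeg 1 K

1/ℕ≡1/fromℕ : ∀ k → 1/ℕ (suc k) ≡ 1/ fromℕ (suc k)
1/ℕ≡1/fromℕ k = ↥p/↧p≡p (1/ fromℕ (suc k))

1/ℕ-*-fromℕ : ∀ K .{{_ : NonZero K}} → 1/ℕ K * fromℕ K ≡ 1ℚ
1/ℕ-*-fromℕ (suc k) = trans (cong (_* fromℕ (suc k)) (1/ℕ≡1/fromℕ k)) (*-inverseˡ (fromℕ (suc k)))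

*-1/ℕ-*-fromℕ : ∀ s K .{{_ : NonZero K}} → s * (1/ℕ K) * fromℕ K ≡ s
*-1/ℕ-*-fromℕ s K = trans (*-assoc s (1/ℕ K) (fromℕ K)) (trans (cong (s *_) (1/ℕ-*-fromℕ K)) (*-identityʳ s))

*-fromℕ-*-1/ℕ : ∀ s K .{{_ : NonZero K}} → s * fromℕ K * (1/ℕ K) ≡ s
*-fromℕ-*-1/ℕ s K = trans (*-assoc s (fromℕ K) (1/ℕ K))
                           (trans (cong (s *_) (trans (*-comm (fromℕ K) (1/ℕ K)) (1/ℕ-*-fromℕ K))) (*-identityʳ s))

*+*≤⊔*+ : ∀ a b p q .{{_ : NonNegative p}} .{{_ : NonNegative q}} → a * p + b * q ≤ (a ⊔ b) * (p + q)
*+*≤⊔*+ a b p q = begin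
  a * p + b * q             ≤⟨ +-mono-≤ (*-monoʳ-≤-nonNeg p (p≤p⊔q a b)) (*-monoʳ-≤-nonNeg q (p≤q⊔p a b)) ⟩
  (a ⊔ b) * p + (a ⊔ b) * q ≡⟨ *-distribˡ-+ (a ⊔ b) p q ⟨
  (a ⊔ b) * (p + q)         ∎
  where open ≤-Reasoning

mediant≤⊔ : ∀ s₁ s₂ K₁ K₂ K .{{_ : NonZero K₁}} .{{_ : NonZero K₂}} .{{_ : NonZero K}} →
            K₁ ℕ.+ K₂ ≡ K → (s₁ + s₂) * (1/ℕ K) ≤ s₁ * (1/ℕ K₁) ⊔ s₂ * (1/ℕ K₂)
mediant≤⊔ s₁ s₂ K₁ K₂ K refl = begin
  (s₁ + s₂) * (1/ℕ K)
    ≡⟨ cong (_* (1/ℕ K)) (cong₂ _+_ (*-1/ℕ-*-fromℕ s₁ K₁) (*-1/ℕ-*-fromℕ s₂ K₂)) ⟨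
  (a₁ * fromℕ K₁ + a₂ * fromℕ K₂) * (1/ℕ K)
    ≤⟨ *-monoʳ-≤-nonNeg (1/ℕ K) {{1/ℕ-nonNeg K}} (*+*≤⊔*+ a₁ a₂ (fromℕ K₁) (fromℕ K₂)) ⟩
  (a₁ ⊔ a₂) * (fromℕ K₁ + fromℕ K₂) * (1/ℕ K)
    ≡⟨ cong (λ k → (a₁ ⊔ a₂) * k * (1/ℕ K)) (fromℕ-+ K₁ K₂) ⟨
  (a₁ ⊔ a₂) * fromℕ K * (1/ℕ K)
    ≡⟨ *-fromℕ-*-1/ℕ (a₁ ⊔ a₂) K ⟩
  a₁ ⊔ a₂
    ∎
  where
  open ≤-Reasoning
  a₁ = s₁ * (1/ℕ K₁)
  a₂ = s₂ * (1/ℕ K₂)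

sumℚ-++ : ∀ xs ys → sumℚ (xs ++ ys) ≡ sumℚ xs + sumℚ ys
sumℚ-++ []       ys = sym (+-identityˡ (sumℚ ys))
sumℚ-++ (x ∷ xs) ys = trans (cong (x +_) (sumℚ-++ xs ys)) (sym (+-assoc x (sumℚ xs) (sumℚ ys)))

sumℚ-map-+ : ∀ {A : Set} (f g : A → ℚ) xs →
             sumℚ (List.map (λ z → f z + g z) xs) ≡ sumℚ (List.map f xs) + sumℚ (List.map g xs)
sumℚ-map-+ f g []       = refl
sumℚ-map-+ f g (x ∷ xs) =
  trans (cong ((f x + g x) +_) (sumℚ-map-+ f g xs))
        (interchange (f x) (g x) (sumℚ (List.map f xs)) (sumℚ (List.map g xs)))

sumℚ-map-0 : ∀ {A : Set} (xs : List A) → sumℚ (List.map (λ _ → 0ℚ) xs) ≡ 0ℚ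
sumℚ-map-0 []       = refl
sumℚ-map-0 (x ∷ xs) = trans (cong (0ℚ +_) (sumℚ-map-0 xs)) (+-identityˡ 0ℚ)

sumℚ-comm : ∀ {A B : Set} (f : A → B → ℚ) xs ys →
            sumℚ (List.map (λ x → sumℚ (List.map (f x) ys)) xs) ≡
            sumℚ (List.map (λ y → sumℚ (List.map (λ x → f x y) xs)) ys)
sumℚ-comm f []       ys = sym (sumℚ-map-0 ys)
sumℚ-comm f (x ∷ xs) ys =
  trans (cong (sumℚ (List.map (f x) ys) +_) (sumℚ-comm f xs ys))
        (sym (sumℚ-map-+ (f x) (λ y → sumℚ (List.map (λ x → f x y) xs)) ys))

infix 4 _≤ᴹ_

_≤ᴹ_ : ℚ → MVal → Set
q ≤ᴹ nothing = ⊤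
q ≤ᴹ just m  = q ≤ m

≤-≤ᴹ-trans : ∀ {p q} M → p ≤ q → q ≤ᴹ M → p ≤ᴹ M
≤-≤ᴹ-trans nothing  _   _   = tt
≤-≤ᴹ-trans (just m) p≤q q≤m = ≤-trans p≤q q≤m

⊔-lubᴹ : ∀ {p q} M → p ≤ᴹ M → q ≤ᴹ M → p ⊔ q ≤ᴹ M
⊔-lubᴹ nothing  _   _   = tt
⊔-lubᴹ (just m) p≤m q≤m = ⊔-lub p≤m q≤m

module _ {n : ℕ} (G : WGraph n) where
  open WGraph G using (w)
  open import Data.List.Relation.Binary.Permutation.Setoid.Properties (≡.setoid (Node n)) using (AllPairs-resp-↭)

  cut-++ˡ : ∀ X Y Z → cut G (X ⁺++⁺ Y) Z ≡ cut G X Z + cut G Y Z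
  cut-++ˡ X Y Z = trans (cong sumℚ (List.map-++ row (List⁺.toList X) (List⁺.toList Y)))
                        (sumℚ-++ (List.map row (List⁺.toList X)) (List.map row (List⁺.toList Y)))
    where
    row : Fin n → ℚ
    row x = sumℚ (List.map (w x) (List⁺.toList Z))

  cut-sym : ∀ X Y → cut G X Y ≡ cut G Y X
  cut-sym X Y = trans (sumℚ-comm w (List⁺.toList X) (List⁺.toList Y))
    (cong sumℚ (List.map-cong (λ y → cong sumℚ (List.map-cong (λ x → WGraph.sym G x y) (List⁺.toList X))) (List⁺.toList Y)))

  W-sym : ∀ X Y → W G X Y ≡ W G Y X
  W-sym X Y = cong₂ _*_ (cut-sym X Y) (/-cong {ℤ.+ 1} refl (ℕ.*-comm (∣ X ∣) (∣ Y ∣)))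

  W-++ˡ : ∀ X Y Z → W G (X ⁺++⁺ Y) Z ≤ W G X Z ⊔ W G Y Z
  W-++ˡ X Y Z = begin
    W G (X ⁺++⁺ Y) Z
      ≡⟨ cong (_* 1/ℕ (∣ X ⁺++⁺ Y ∣ ℕ.* ∣ Z ∣)) (cut-++ˡ X Y Z) ⟩
    (cut G X Z + cut G Y Z) * 1/ℕ (∣ X ⁺++⁺ Y ∣ ℕ.* ∣ Z ∣)
      ≤⟨ mediant≤⊔ (cut G X Z) (cut G Y Z) (∣ X ∣ ℕ.* ∣ Z ∣) (∣ Y ∣ ℕ.* ∣ Z ∣) _ sizes ⟩
    W G X Z ⊔ W G Y Z
      ∎
    where
    open ≤-Reasoning
    sizes : ∣ X ∣ ℕ.* ∣ Z ∣ ℕ.+ ∣ Y ∣ ℕ.* ∣ Z ∣ ≡ ∣ X ⁺++⁺ Y ∣ ℕ.* ∣ Z ∣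
    sizes = trans (sym (ℕ.*-distribʳ-+ (∣ Z ∣) (∣ X ∣) (∣ Y ∣))) (cong (ℕ._* ∣ Z ∣) (sym (length-⁺++⁺ X Y)))

  minM-≤ : ∀ M q → minM G M q ≤ q
  minM-≤ nothing  q = ≤-refl
  minM-≤ (just m) q = p⊓q≤q m q

  minM-greatest : ∀ {p q} M → p ≤ q → p ≤ᴹ M → p ≤ minM G M q
  minM-greatest nothing  p≤q _   = p≤q
  minM-greatest (just m) p≤q p≤m = ⊓-glb p≤m p≤q

  wmax-≥ : ∀ u {x l} → x ∈ l → Wn G u x ≤ wmax G u l
  wmax-≥ u {l = x ∷ l} (here refl) = p≤p⊔q (Wn G u x) (wmax G u l)
  wmax-≥ u {l = y ∷ l} (there x∈l) = ≤-trans (wmax-≥ u x∈l) (p≤q⊔p (Wn G u y) (wmax G u l))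

  BoundedByM : Node n → Node n → Set
  BoundedByM x y = Wn G x y ≤ᴹ proj₂ x × Wn G x y ≤ᴹ proj₂ y

  boundedByM-sym : Symmetric BoundedByM
  boundedByM-sym {x} {y} (≤Mx , ≤My) = subst (_≤ᴹ proj₂ y) xy≡yx ≤My , subst (_≤ᴹ proj₂ x) xy≡yx ≤Mx
    where
    xy≡yx : Wn G x y ≡ Wn G y x
    xy≡yx = W-sym (proj₁ x) (proj₁ y)

  MBounded : State n → Set
  MBounded = AllPairs BoundedByM

  mBounded-resp-↭ : ∀ {P Q} → P ↭ Q → MBounded P → MBounded Q
  mBounded-resp-↭ P↭Q =
    AllPairs-resp-↭ {R = BoundedByM} (λ {x} {y} → boundedByM-sym {x} {y}) (resp₂ BoundedByM) (↭⇒↭ₛ P↭Q)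

  1-good⇔ : ∀ u v rest → Good G 0ℚ u v rest ⇔ (wmax G u (v ∷ rest) ⊔ wmax G v (u ∷ rest) ≤ minMuv G u v)
  1-good⇔ u v rest = mk⇔ (subst (max-wmax ≤_) 1*M≡M) (subst (max-wmax ≤_) (sym 1*M≡M))
    where
    max-wmax : ℚ
    max-wmax = wmax G u (v ∷ rest) ⊔ wmax G v (u ∷ rest)
    1*M≡M : (1ℚ + 0ℚ) * minMuv G u v ≡ minMuv G u v
    1*M≡M = *-identityˡ (minMuv G u v)

  merge-boundedByM : ∀ u v rest {x} → Good G 0ℚ u v rest → x ∈ rest →
                     BoundedByM u x → BoundedByM v x → BoundedByM (merge G u v) x
  merge-boundedByM u v rest {x} good x∈rest (_ , ux≤Mx) (_ , vx≤Mx) =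
    ≤-trans merged≤ux⊔vx ux⊔vx≤M[merged] , ≤-≤ᴹ-trans (proj₂ x) merged≤ux⊔vx (⊔-lubᴹ (proj₂ x) ux≤Mx vx≤Mx)
    where
    merged≤ux⊔vx : Wn G (merge G u v) x ≤ Wn G u x ⊔ Wn G v x
    merged≤ux⊔vx = W-++ˡ (proj₁ u) (proj₁ v) (proj₁ x)
    ux⊔vx≤M[merged] : Wn G u x ⊔ Wn G v x ≤ minMuv G u v
    ux⊔vx≤M[merged] = ≤-trans (⊔-mono-≤ (wmax-≥ u {l = v ∷ rest} (there x∈rest)) (wmax-≥ v {l = u ∷ rest} (there x∈rest)))
                              (Equivalence.to (1-good⇔ u v rest) good)

  goodStep-mBounded : ∀ {P Q} → GoodStep G 0ℚ P Q → MBounded P → MBounded Q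
  goodStep-mBounded (step u v rest P↭ _ good) bounded = merged (mBounded-resp-↭ P↭ bounded)
    where
    merged : MBounded (u ∷ v ∷ rest) → MBounded (merge G u v ∷ rest)
    merged ((_ ∷ u-rest) ∷ v-rest ∷ rest-bounded) =
      All.tabulate (λ x∈rest → merge-boundedByM u v rest good x∈rest (All.lookup u-rest x∈rest) (All.lookup v-rest x∈rest))
      ∷ rest-bounded

  singletons-mBounded : (xs : List (Fin n)) → MBounded (List.map (λ x → [ x ] , nothing) xs)
  singletons-mBounded []       = []
  singletons-mBounded (x ∷ xs) = All.map⁺ (All.universal (λ _ → tt , tt) xs) ∷ singletons-mBounded xs

  reachable-mBounded : ∀ {P} → ReachableBy1Good G P → MBounded P
  reachable-mBounded = go (singletons-mBounded (List.allFin n))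
    where
    go : ∀ {P Q} → MBounded P → Star (GoodStep G 0ℚ) P Q → MBounded Q
    go bounded ε        = bounded
    go bounded (s ◅ ss) = go (goodStep-mBounded s bounded) ss

  minMuv-≤-Wn : ∀ u v → minMuv G u v ≤ Wn G u v
  minMuv-≤-Wn u v = ≤-trans (minM-≤ (proj₂ u) _) (minM-≤ (proj₂ v) (Wn G u v))

  Wn-≤-minMuv : ∀ u v → BoundedByM u v → Wn G u v ≤ minMuv G u v
  Wn-≤-minMuv u v (≤Mu , ≤Mv) = minM-greatest (proj₂ u) (minM-greatest (proj₂ v) ≤-refl ≤Mv) ≤Mu

  Wn-≤-wmax⊔wmax : ∀ u v rest → Wn G u v ≤ wmax G u (v ∷ rest) ⊔ wmax G v (u ∷ rest)
  Wn-≤-wmax⊔wmax u v rest = ≤-trans (wmax-≥ u {l = v ∷ rest} (here refl)) (p≤p⊔q _ _)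

mainTheorem3 : (n : ℕ) (G : WGraph n) (P : State n) → ReachableBy1Good G P →
    (u v : Node n) (rest : List (Node n)) → P ↭ (u ∷ v ∷ rest) → Adjacent G u v →
    (Good G 0ℚ u v rest ⇔ (Wn G u v ≡ (wmax G u (v ∷ rest) ⊔ wmax G v (u ∷ rest))))
mainTheorem3 n G P reachable u v rest P↭ _ = mk⇔
  (λ good → ≤-antisym (Wn-≤-wmax⊔wmax G u v rest) (≤-trans (to good) (minMuv-≤-Wn G u v)))
  (λ w≡max → from (≤-trans (≤-reflexive (sym w≡max)) (Wn-≤-minMuv G u v u∼v)))
  where
  open Equivalence (1-good⇔ G u v rest)
  u∼v : BoundedByM G u v
  u∼v with mBounded-resp-↭ G P↭ (reachable-mBounded G reachable)
  ... | (u∼v ∷ _) ∷ _ = u∼v
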